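{- Let $G=(V,E,\sigma)$ be a graph and let $\Gamma$ be any nonempty family of walks on $G$. Then $$\mathrm{Mod}_\infty(\Gamma)=\frac{1}{\ell(\Gamma)}.$$
   Context: A graph $G=(V,E,\sigma)$ is a simple (directed or undirected) graph with finite vertex set $V$, finite edge set $E$, and weights $\sigma:E\to(0,\infty)$. A walk is a string of edges $e_1\ldots e_r$ ($r\ge1$) forming a walk in $G$; its graph length is $\ell(\gamma)=r$, and $\ell(\Gamma)=\inf_{\gamma\in\Gamma}\ell(\gamma)$. For $\rho:E\to\mathbb{R}$, $\ell_\rho(\gamma)=\sum_{i=1}^r\rho(e_i)$, $\ell_\rho(\Gamma)=\inf_{\gamma\in\Gamma}\ell_\rho(\gamma)$, $A(\Gamma)=\{\rho:E\to\mathbb{R}:\ \ell_\rho(\Gamma)\ge1,\ \rho\ge0\}$, and $\mathrm{Mod}_\infty(\Gamma)=\inf_{\rho\in A(\Gamma)}\max_{e\in E}|\rho(e)|$.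
   Formalization: Each ρ in $A(\Gamma)$ takes values in ℚ rather than ℝ, so the infimum defining $\mathrm{Mod}_\infty(\Gamma)$ is taken among rationals, and the weights σ are rational. -}

module Defs where

open import Data.Nat using (ℕ; zero; suc)
open import Data.Fin using (Fin)
open import Data.Bool using (Bool; true; false)
open import Data.Product using (_×_; _,_; proj₁; proj₂; ∃)
open import Data.Sum using (_⊎_)
open import Data.List using (List; []; _∷_; length; foldr; map)
open import Data.Integer using (+_)
open import Data.Rational using (ℚ; 0ℚ; 1ℚ; _≤_; _<_; _+_; _⊔_; ∣_∣; _/_)
open import Relation.Binary.PropositionalEquality using (_≡_; _≢_)
open import Relation.Nullary using (¬_)

-- Edges: Fin m, edge e has endpoints (tail e , head e);
-- for an undirected graph (directed = false) these are just the two ends.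
record Graph : Set where
  field
    n m       : ℕ
    directed  : Bool
    ends      : Fin m → Fin n × Fin n
    σ         : Fin m → ℚ
    σ-pos     : ∀ e → 0ℚ < σ e
    loopless  : ∀ e → proj₁ (ends e) ≢ proj₂ (ends e)
    no-multi  : ∀ e e' → ends e ≡ ends e' → e ≡ e'
    no-multi-rev : directed ≡ false →
                   ∀ e e' → proj₁ (ends e) ≡ proj₂ (ends e') →
                            proj₂ (ends e) ≡ proj₁ (ends e') → e ≡ e'

module _ (G : Graph) where
  open Graph G

  Traverses : Fin m → Fin n → Fin n → Set
  Traverses e u v with directed
  ... | true  = ends e ≡ (u , v)
  ... | false = ends e ≡ (u , v) ⊎ ends e ≡ (v , u)

  data WalkFrom : Fin n → List (Fin m) → Set where
    one  : ∀ {u v e} → Traverses e u v → WalkFrom u (e ∷ [])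
    step : ∀ {u v e es} → Traverses e u v → WalkFrom v es → WalkFrom u (e ∷ es)

  IsWalk : List (Fin m) → Set
  IsWalk γ = ∃ λ u → WalkFrom u γ

  Family : Set₁
  Family = List (Fin m) → Set

  -- ℓ(Γ) = L : the infimum of graph lengths over Γ (attained, lengths ∈ ℕ)
  IsGraphLength : Family → ℕ → Set
  IsGraphLength Γ L = (∃ λ γ → Γ γ × length γ ≡ L)
                    × (∀ γ → Γ γ → L Data.Nat.≤ length γ)

  ℓρ : (Fin m → ℚ) → List (Fin m) → ℚ
  ℓρ ρ γ = foldr _+_ 0ℚ (map ρ γ)

  Admissible : Family → (Fin m → ℚ) → Set
  Admissible Γ ρ = (∀ e → 0ℚ ≤ ρ e) × (∀ γ → Γ γ → 1ℚ ≤ ℓρ ρ γ)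

  -- max_{e ∈ E} |ρ(e)|  (0 if E = ∅)
  maxAbs : (Fin m → ℚ) → ℚ
  maxAbs ρ = foldr _⊔_ 0ℚ (map (λ e → ∣ ρ e ∣) (Data.List.allFin m))

  IsModInfty : Family → ℚ → Set
  IsModInfty Γ x = (∀ ρ → Admissible Γ ρ → x ≤ maxAbs ρ)
                 × (∀ y → (∀ ρ → Admissible Γ ρ → y ≤ maxAbs ρ) → y ≤ x)

-- 1 / L as a rational (L ≥ 1 in the theorem; value at 0 irrelevant)
inv : ℕ → ℚ
inv zero    = 0ℚ
inv (suc k) = + 1 / suc k

{-# OPTIONS --safe #-}
-- A shortest walk γ₀ ∈ Γ, of length L, bounds every admissible ρ from below:
-- 1 ≤ ℓ_ρ(γ₀) ≤ L · max ρ.  Conversely the constant density 1/L is admissible,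
-- since every walk of Γ has at least L edges, and its maximum is 1/L.
module Submission where

open import Defs
open import Algebra.Bundles using (CommutativeRing)
open import Data.Integer as ℤ using (+_)
import Data.Integer.Properties as ℤ
open import Data.List using (List; []; _∷_; length; foldr; map; allFin)
open import Data.List.Membership.Propositional using (_∈_)
open import Data.List.Membership.Propositional.Properties using (∈-allFin)
open import Data.List.Relation.Unary.Any using (here; there)
open import Data.Nat as ℕ using (ℕ; zero; suc; z≤n; s≤s)
open import Data.Product using (_,_; ∃)
open import Data.Rational
open import Data.Rational.Properties
open import Data.Rational.Unnormalised as ℚᵘ
  using (mkℚᵘ; 1ℚᵘ; *≡*) renaming (_+_ to _+ᵘ_; _*_ to _*ᵘ_)
import Data.Rational.Unnormalised.Properties as ℚᵘ
open import Function using (const)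
open import Relation.Binary.PropositionalEquality

open import Algebra.Properties.Semiring.Mult
  (CommutativeRing.semiring +-*-commutativeRing)
  using (_×_; ×-comm-*; ×-assoc-*)

1+[n/1]≡[1+n]/1 : ∀ n → 1ℚ + + n / 1 ≡ + suc n / 1
1+[n/1]≡[1+n]/1 n = toℚᵘ-injective (begin
  toℚᵘ (1ℚ + + n / 1)           ≈⟨ toℚᵘ-homo-+ 1ℚ (+ n / 1) ⟩
  1ℚᵘ +ᵘ toℚᵘ (+ n / 1)          ≈⟨ ℚᵘ.+-congʳ 1ℚᵘ (toℚᵘ-fromℚᵘ (mkℚᵘ (+ n) 0)) ⟩
  1ℚᵘ +ᵘ mkℚᵘ (+ n) 0            ≈⟨ *≡* (cong (λ i → (+ 1 ℤ.+ i) ℤ.* + 1) (ℤ.*-identityʳ (+ n))) ⟩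
  mkℚᵘ (+ suc n) 0              ≈⟨ toℚᵘ-fromℚᵘ (mkℚᵘ (+ suc n) 0) ⟨
  toℚᵘ (+ suc n / 1)            ∎)
  where open ℚᵘ.≃-Reasoning

n/1*1/n≡1 : ∀ n .{{_ : ℕ.NonZero n}} → + n / 1 * (+ 1 / n) ≡ 1ℚ
n/1*1/n≡1 (suc k) = toℚᵘ-injective (begin
  toℚᵘ (+ suc k / 1 * (+ 1 / suc k))            ≈⟨ toℚᵘ-homo-* (+ suc k / 1) (+ 1 / suc k) ⟩
  toℚᵘ (+ suc k / 1) *ᵘ toℚᵘ (+ 1 / suc k)      ≈⟨ ℚᵘ.*-cong (toℚᵘ-fromℚᵘ (mkℚᵘ (+ suc k) 0))
                                                              (toℚᵘ-fromℚᵘ (mkℚᵘ (+ 1) k)) ⟩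
  mkℚᵘ (+ suc k) 0 *ᵘ mkℚᵘ (+ 1) k              ≈⟨ ℚᵘ.*-inverseʳ (mkℚᵘ (+ suc k) 0) ⟩
  1ℚᵘ                                           ∎)
  where open ℚᵘ.≃-Reasoning

n×1≡n/1 : ∀ n → n × 1ℚ ≡ + n / 1
n×1≡n/1 zero    = refl
n×1≡n/1 (suc n) = trans (cong (_+_ 1ℚ) (n×1≡n/1 n)) (1+[n/1]≡[1+n]/1 n)

n×1/n≡1 : ∀ n .{{_ : ℕ.NonZero n}} → n × (+ 1 / n) ≡ 1ℚ
n×1/n≡1 n = begin
  n × (+ 1 / n)           ≡⟨ cong (n ×_) (*-identityˡ (+ 1 / n)) ⟨
  n × (1ℚ * (+ 1 / n))    ≡⟨ ×-assoc-* n 1ℚ (+ 1 / n) ⟨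
  n × 1ℚ * (+ 1 / n)      ≡⟨ cong (_* (+ 1 / n)) (n×1≡n/1 n) ⟩
  + n / 1 * (+ 1 / n)     ≡⟨ n/1*1/n≡1 n ⟩
  1ℚ                      ∎
  where open ≡-Reasoning

0≤1/n : ∀ n .{{_ : ℕ.NonZero n}} → 0ℚ ≤ + 1 / n
0≤1/n n = nonNegative⁻¹ (+ 1 / n) {{normalize-nonNeg 1 n}}

1≤n×p⇒1/n≤p : ∀ n .{{_ : ℕ.NonZero n}} {p} → 1ℚ ≤ n × p → + 1 / n ≤ p
1≤n×p⇒1/n≤p n {p} 1≤n×p = begin
  + 1 / n                 ≡⟨ *-identityʳ (+ 1 / n) ⟨
  + 1 / n * 1ℚ            ≤⟨ *-monoˡ-≤-nonNeg (+ 1 / n) {{normalize-nonNeg 1 n}} 1≤n×p ⟩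
  + 1 / n * (n × p)       ≡⟨ ×-comm-* n (+ 1 / n) p ⟩
  n × (+ 1 / n * p)       ≡⟨ ×-assoc-* n (+ 1 / n) p ⟨
  n × (+ 1 / n) * p       ≡⟨ cong (_* p) (n×1/n≡1 n) ⟩
  1ℚ * p                  ≡⟨ *-identityˡ p ⟩
  p                       ∎
  where open ≤-Reasoning

×-nonNeg : ∀ n {p} → 0ℚ ≤ p → 0ℚ ≤ n × p
×-nonNeg zero    0≤p = ≤-refl
×-nonNeg (suc n) 0≤p = +-mono-≤ 0≤p (×-nonNeg n 0≤p)

×-monoˡ-≤ : ∀ {m n p} → 0ℚ ≤ p → m ℕ.≤ n → m × p ≤ n × p
×-monoˡ-≤ {n = n} 0≤p z≤n       = ×-nonNeg n 0≤p
×-monoˡ-≤ {p = p} 0≤p (s≤s m≤n) = +-monoʳ-≤ p (×-monoˡ-≤ 0≤p m≤n)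

module _ {A : Set} where

  foldr-+-map-const : ∀ p (xs : List A) → foldr _+_ 0ℚ (map (const p) xs) ≡ length xs × p
  foldr-+-map-const p []       = refl
  foldr-+-map-const p (_ ∷ xs) = cong (_+_ p) (foldr-+-map-const p xs)

  foldr-+-map-≤ : ∀ {f : A → ℚ} {p} → (∀ x → f x ≤ p) →
                  ∀ xs → foldr _+_ 0ℚ (map f xs) ≤ length xs × p
  foldr-+-map-≤ f≤p []       = ≤-refl
  foldr-+-map-≤ f≤p (x ∷ xs) = +-mono-≤ (f≤p x) (foldr-+-map-≤ f≤p xs)

  ≤-foldr-⊔-map : ∀ (f : A → ℚ) {x xs} → x ∈ xs → f x ≤ foldr _⊔_ 0ℚ (map f xs)
  ≤-foldr-⊔-map f {xs = y ∷ _} (here refl)  = p≤p⊔q (f y) _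
  ≤-foldr-⊔-map f {xs = y ∷ _} (there x∈xs) = ≤-trans (≤-foldr-⊔-map f x∈xs) (p≤q⊔p (f y) _)

  foldr-⊔-map-≤ : ∀ {f : A → ℚ} {p} → 0ℚ ≤ p → (∀ x → f x ≤ p) →
                  ∀ xs → foldr _⊔_ 0ℚ (map f xs) ≤ p
  foldr-⊔-map-≤ 0≤p f≤p []       = 0≤p
  foldr-⊔-map-≤ 0≤p f≤p (x ∷ xs) = ⊔-lub (f≤p x) (foldr-⊔-map-≤ 0≤p f≤p xs)

module _ (G : Graph) where
  open Graph G using (m)

  walk-length-nonZero : ∀ {γ} → IsWalk G γ → ℕ.NonZero (length γ)
  walk-length-nonZero (_ , one _)    = _
  walk-length-nonZero (_ , step _ _) = _

  ≤-maxAbs : ∀ {ρ} e → 0ℚ ≤ ρ e → ρ e ≤ maxAbs G ρ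
  ≤-maxAbs {ρ} e 0≤ρe = subst (_≤ maxAbs G ρ) (0≤p⇒∣p∣≡p 0≤ρe)
    (≤-foldr-⊔-map (λ e → ∣ ρ e ∣) (∈-allFin e))

  maxAbs-const-≤ : ∀ {p} → 0ℚ ≤ p → maxAbs G (const p) ≤ p
  maxAbs-const-≤ 0≤p =
    foldr-⊔-map-≤ 0≤p (λ _ → ≤-reflexive (0≤p⇒∣p∣≡p 0≤p)) (allFin m)

  module _ {Γ : Family G} where

    1/length≤maxAbs : ∀ {γ} .{{_ : ℕ.NonZero (length γ)}} → Γ γ →
                      ∀ ρ → Admissible G Γ ρ → + 1 / length γ ≤ maxAbs G ρ
    1/length≤maxAbs {γ} γ∈Γ ρ (ρ≥0 , ℓρ≥1) = 1≤n×p⇒1/n≤p (length γ) (begin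
      1ℚ                        ≤⟨ ℓρ≥1 γ γ∈Γ ⟩
      ℓρ G ρ γ                  ≤⟨ foldr-+-map-≤ (λ e → ≤-maxAbs e (ρ≥0 e)) γ ⟩
      length γ × maxAbs G ρ     ∎)
      where open ≤-Reasoning

    const-1/L-admissible : ∀ {L} .{{_ : ℕ.NonZero L}} → (∀ γ → Γ γ → L ℕ.≤ length γ) →
                           Admissible G Γ (const (+ 1 / L))
    const-1/L-admissible {L} L≤length = (λ _ → 0≤1/n L) , ℓ≥1
      where
      ℓ≥1 : ∀ γ → Γ γ → 1ℚ ≤ ℓρ G (const (+ 1 / L)) γ
      ℓ≥1 γ γ∈Γ = begin
        1ℚ                          ≡⟨ n×1/n≡1 L ⟨
        L × (+ 1 / L)               ≤⟨ ×-monoˡ-≤ (0≤1/n L) (L≤length γ γ∈Γ) ⟩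
        length γ × (+ 1 / L)        ≡⟨ foldr-+-map-const (+ 1 / L) γ ⟨
        ℓρ G (const (+ 1 / L)) γ    ∎
        where open ≤-Reasoning

inv≡1/n : ∀ n .{{_ : ℕ.NonZero n}} → inv n ≡ + 1 / n
inv≡1/n (suc n) = refl

mainTheorem3 : (G : Graph) (Γ : Family G) →
               (∀ γ → Γ γ → IsWalk G γ) →
               (∃ λ γ → Γ γ) →
               (L : ℕ) → IsGraphLength G Γ L →
               IsModInfty G Γ (inv L)
-- Nonemptiness of Γ is already witnessed by the shortest walk in IsGraphLength.
mainTheorem3 G Γ walks _ _ ((γ , γ∈Γ , refl) , shortest) =
  subst (IsModInfty G Γ) (sym (inv≡1/n (length γ)))
    ( 1/length≤maxAbs G γ∈Γ
    , λ y y≤maxAbs → ≤-trans (y≤maxAbs _ (const-1/L-admissible G shortest))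
                             (maxAbs-const-≤ G (0≤1/n (length γ))))
  where
  instance
    length-nonZero : ℕ.NonZero (length γ)
    length-nonZero = walk-length-nonZero G (walks γ γ∈Γ)
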